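{- For all primes $p\geq 7$, \[ \sum_{\substack{n=1\\ p\nmid n}}^{p^2}\frac1n\equiv p^2\sum_{n=1}^{p-1}\frac1n\pmod{p^6}. \]
   Context: For rationals $x,y$, $x\equiv y\pmod{p^6}$ means the numerator of $x-y$ is divisible by $p^6$. -}

module Defs where

open import Data.Nat as ℕ using (ℕ; zero; suc; _^_)
open import Data.Nat.Divisibility using (_∣?_)
open import Data.Integer as ℤ using (ℤ; +_)
open import Data.Integer.Divisibility using () renaming (_∣_ to _∣ℤ_)
open import Data.Rational as ℚ using (ℚ; 0ℚ; ↥_)
open import Relation.Nullary.Decidable using (does)
open import Data.Bool using (if_then_else_)

-- reciprocal 1/n of a natural number, with the convention 1/0 = 0
-- (only ever used for n ≥ 1 below)
recip : ℕ → ℚ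
recip zero    = 0ℚ
recip (suc k) = (+ 1) ℚ./ (suc k)

H : ℕ → ℚ
H zero    = 0ℚ
H (suc n) = H n ℚ.+ recip (suc n)

Hcoprime : ℕ → ℕ → ℚ
Hcoprime p zero    = 0ℚ
Hcoprime p (suc n) =
  if does (p ∣? suc n) then Hcoprime p n else Hcoprime p n ℚ.+ recip (suc n)

-- x ≡ y (mod m) for rationals: m divides the numerator of x - y
-- (ℚ is kept in lowest terms, so this is the numerator of the reduced fraction)
_≡_[modℚ_] : ℚ → ℚ → ℕ → Set
x ≡ y [modℚ m ] = (+ m) ∣ℤ (↥ (x ℚ.- y))

module Submission where

-- Every n ≤ p² prime to p is k p + a with 0 ≤ k < p and 1 ≤ a < p, and modulo p⁶
--   1 / (k p + a) ≡ Σᵢ₌₀⁵ (− k p)ⁱ / aⁱ⁺¹.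
-- Summing over k and a turns the left-hand side into Σᵢ (− p)ⁱ Sᵢ Bᵢ₊₁, with the power sums
-- Sᵢ = 0ⁱ + 1ⁱ + … + (p − 1)ⁱ given by Faulhaber's formulas and Bⱼ = Σₐ a⁻ʲ over 1 ≤ a < p.
-- Pairing a with p − a gives 2 B₁ + p B₂ + … + p⁵ B₆ ≡ 0 (mod p⁶), 2 B₃ + 3 p B₄ + 6 p² B₅ ≡ 0 (mod p³)
-- and 2 B₅ ≡ 0 (mod p), while a ↦ a⁻¹ permutes the residues, so B₄ ≡ S₄ ≡ 0 (mod p). As p ∤ 60, these
-- relations reduce the sum to p² B₁, which is p² H(p − 1). Throughout, a rational whose denominator is
-- prime to p is replaced by its image in ℤ/p⁶.

open import Defs
open import Agda.Builtin.FromNat using (Number; fromNat)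
open import Data.Fin as Fin using (Fin; toℕ)
open import Data.Fin.Patterns using (0F; 1F; 2F; 3F; 4F; 5F)
open import Data.Fin.Permutation using (permutation; reverse)
import Data.Fin.Properties as FinP
open import Data.Integer using (ℤ; +_; 0ℤ; 1ℤ; _+_; _*_; -_; _-_)
open import Data.Integer.DivMod using (_%ℕ_; _/ℕ_; n%ℕd<d; a≡a%ℕn+[a/ℕn]*n)
open import Data.Integer.Divisibility using () renaming (_∣_ to _∣ᵤ_)
open import Data.Integer.Divisibility.Signed
  using (_∣_; divides; ∣⇒∣ᵤ; ∣-refl; ∣-trans; *-monoʳ-∣; ∣m∣n⇒∣m+n; ∣m⇒∣-m; ∣m⇒∣m*n; ∣n⇒∣m*n)
open import Data.Integer.GCD using (gcd)
import Data.Integer.Literals as ℤLiterals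
import Data.Integer.Properties as ℤP
open import Data.Integer.Tactic.RingSolver using (solve-∀; solve; ring)
open import Data.List using (_∷_; [])
open import Data.Nat as ℕ using (ℕ; zero; suc; _≤_; _<_; _≥_; s≤s; z≤n; _∸_)
open import Data.Nat.Coprimality using (Coprime; coprime-Bézout)
open import Data.Nat.Divisibility using (_∣?_; >⇒∤; ∣m+n∣m⇒∣n; n∣m*n) renaming (_∣_ to _∣ℕ_)
open import Data.Nat.GCD using (module Bézout)
import Data.Nat.Literals as ℕLiterals
open import Data.Nat.Primality using (Prime; prime⇒irreducible; euclidsLemma)
import Data.Nat.Properties as ℕP
open import Data.Product using (_,_)
open import Data.Rational as ℚ using (ℚ; ↥_; ↧_; ↧ₙ_; 0ℚ)
import Data.Rational.Properties as ℚP
open import Data.Sum using (inj₁; inj₂)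
open import Data.Unit using (tt)
open import Function using (_∘_)
open import Relation.Binary.Bundles using (Setoid)
open import Relation.Binary.PropositionalEquality
import Relation.Binary.Reasoning.Setoid as SetoidReasoning
open import Relation.Binary.Structures using (IsEquivalence)
open import Relation.Nullary using (¬_; yes; no; contradiction)
open import Relation.Nullary.Decidable using (from-yes)
open import Tactic.RingSolver.Core.AlmostCommutativeRing using (module AlmostCommutativeRing)
open import Algebra.Properties.CommutativeSemiring.Exp.TCOptimised ℤP.+-*-commutativeSemiring
  using (^-distrib-*; ^-homo-*)
open import Algebra.Properties.Semiring.Sum ℤP.+-*-semiring
  using (sum; sum-syntax; sum-cong-≗; sum-init-last; sum-permute; ∑-comm; *-distribˡ-sum)

-- The ring solver only recognises the exponentiation of its own ring structure.
open AlmostCommutativeRing ring using (_^_)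

instance
  ℤ-number : Number ℤ
  ℤ-number = ℤLiterals.number
  ℕ-number : Number ℕ
  ℕ-number = ℕLiterals.number

infix 4 _≡_[modℤ_]

record _≡_[modℤ_] (x y m : ℤ) : Set where
  constructor modℤ
  field m∣x-y : m ∣ x - y

∣-respʳ : ∀ {m a b} → m ∣ a → a ≡ b → m ∣ b
∣-respʳ m∣a refl = m∣a

module _ {m : ℤ} where

  ≡⇒≡-modℤ : ∀ {x y} → x ≡ y → x ≡ y [modℤ m ]
  ≡⇒≡-modℤ {x} refl = modℤ (divides 0ℤ (solve (x ∷ m ∷ [])))

  ≡-modℤ-refl : ∀ {x} → x ≡ x [modℤ m ]
  ≡-modℤ-refl = ≡⇒≡-modℤ refl

  ≡-modℤ-sym : ∀ {x y} → x ≡ y [modℤ m ] → y ≡ x [modℤ m ]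
  ≡-modℤ-sym {x} {y} (modℤ m∣x-y) = modℤ (∣-respʳ (∣m⇒∣-m m∣x-y) (solve (x ∷ y ∷ [])))

  ≡-modℤ-trans : ∀ {x y z} → x ≡ y [modℤ m ] → y ≡ z [modℤ m ] → x ≡ z [modℤ m ]
  ≡-modℤ-trans {x} {y} {z} (modℤ m∣x-y) (modℤ m∣y-z) =
    modℤ (∣-respʳ (∣m∣n⇒∣m+n m∣x-y m∣y-z) (solve (x ∷ y ∷ z ∷ [])))

  ≡-modℤ-isEquivalence : IsEquivalence (λ x y → x ≡ y [modℤ m ])
  ≡-modℤ-isEquivalence = record { refl = ≡-modℤ-refl ; sym = ≡-modℤ-sym ; trans = ≡-modℤ-trans }

  +-cong-modℤ : ∀ {x y z w} → x ≡ y [modℤ m ] → z ≡ w [modℤ m ] → x + z ≡ y + w [modℤ m ]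
  +-cong-modℤ {x} {y} {z} {w} (modℤ m∣x-y) (modℤ m∣z-w) =
    modℤ (∣-respʳ (∣m∣n⇒∣m+n m∣x-y m∣z-w) (solve (x ∷ y ∷ z ∷ w ∷ [])))

  *-cong-modℤ : ∀ {x y z w} → x ≡ y [modℤ m ] → z ≡ w [modℤ m ] → x * z ≡ y * w [modℤ m ]
  *-cong-modℤ {x} {y} {z} {w} (modℤ m∣x-y) (modℤ m∣z-w) =
    modℤ (∣-respʳ (∣m∣n⇒∣m+n (∣m⇒∣m*n z m∣x-y) (∣n⇒∣m*n y m∣z-w)) (solve (x ∷ y ∷ z ∷ w ∷ [])))

  neg-cong-modℤ : ∀ {x y} → x ≡ y [modℤ m ] → - x ≡ - y [modℤ m ]
  neg-cong-modℤ {x} {y} (modℤ m∣x-y) = modℤ (∣-respʳ (∣m⇒∣-m m∣x-y) (solve (x ∷ y ∷ [])))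

  ^-cong-modℤ : ∀ {x y} n → x ≡ y [modℤ m ] → x ^ n ≡ y ^ n [modℤ m ]
  ^-cong-modℤ zero          _   = ≡-modℤ-refl
  ^-cong-modℤ (suc zero)    x≡y = x≡y
  ^-cong-modℤ (suc (suc n)) x≡y = *-cong-modℤ (^-cong-modℤ (suc n) x≡y) x≡y

  x-km≡x : ∀ x k → x - k * m ≡ x [modℤ m ]
  x-km≡x x k = modℤ (divides (- k) (solve (x ∷ k ∷ m ∷ [])))

≡-modℤ-setoid : ℤ → Setoid _ _
≡-modℤ-setoid m = record { isEquivalence = ≡-modℤ-isEquivalence {m} }

module ≡-modℤ-Reasoning (m : ℤ) = SetoidReasoning (≡-modℤ-setoid m)

≡-modℤ-weaken : ∀ {m n x y} → m ∣ n → x ≡ y [modℤ n ] → x ≡ y [modℤ m ]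
≡-modℤ-weaken m∣n (modℤ n∣x-y) = modℤ (∣-trans m∣n n∣x-y)

*-cong-∣ : ∀ {m n x y} → m ∣ x → n ∣ y → m * n ∣ x * y
*-cong-∣ {m} {n} (divides k refl) (divides l refl) = divides (k * l) (solve (k ∷ l ∷ m ∷ n ∷ []))

∑-snoc : ∀ n (f : ℕ → ℤ) → ∑[ i < suc n ] f (toℕ i) ≡ ∑[ i < n ] f (toℕ i) + f n
∑-snoc n f = trans (sum-init-last {n} (f ∘ toℕ))
  (cong₂ _+_ (sum-cong-≗ {n} (cong f ∘ FinP.toℕ-inject₁)) (cong f (FinP.toℕ-fromℕ n)))

∑-cong-modℤ : ∀ {m n} {f g : Fin n → ℤ} → (∀ i → f i ≡ g i [modℤ m ]) → sum f ≡ sum g [modℤ m ]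
∑-cong-modℤ {n = zero}  _   = ≡-modℤ-refl
∑-cong-modℤ {n = suc n} f≡g = +-cong-modℤ (f≡g 0F) (∑-cong-modℤ (f≡g ∘ Fin.suc))

∑-neg : ∀ {n} (f : Fin n → ℤ) → ∑[ i < n ] (- f i) ≡ - sum f
∑-neg {zero}  f = refl
∑-neg {suc n} f = trans (cong (λ z → - f 0F + z) (∑-neg (f ∘ Fin.suc))) (sym (ℤP.neg-distrib-+ (f 0F) _))

∑-∑-scale : ∀ {d n} (c : Fin d → ℤ) (f : Fin d → Fin n → ℤ) →
            ∑[ a < n ] ∑[ i < d ] (c i * f i a) ≡ ∑[ i < d ] (c i * ∑[ a < n ] f i a)
∑-∑-scale c f = trans (∑-comm (λ a i → c i * f i a)) (sum-cong-≗ λ i → sym (*-distribˡ-sum (c i) (f i)))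

∑-telescope : ∀ (F f : ℕ → ℤ) → F 0 ≡ 0ℤ → (∀ n → F (suc n) ≡ F n + f n) →
              ∀ n → ∑[ i < n ] f (toℕ i) ≡ F n
∑-telescope F f F0≡0 step zero    = sym F0≡0
∑-telescope F f F0≡0 step (suc n) =
  trans (∑-snoc n f) (trans (cong (_+ f n) (∑-telescope F f F0≡0 step n)) (sym (step n)))

^-suc : ∀ x n → x ^ suc n ≡ x ^ n * x
^-suc x n = trans (cong (x ^_) (ℕP.+-comm 1 n)) (^-homo-* x n 1)

pos-^ : ∀ n e → + (n ℕ.^ e) ≡ (+ n) ^ e
pos-^ n zero    = refl
pos-^ n (suc e) = begin
  + (n ℕ.* n ℕ.^ e)  ≡⟨ ℤP.pos-* n (n ℕ.^ e) ⟩
  + n * + (n ℕ.^ e)  ≡⟨ cong (+ n *_) (pos-^ n e) ⟩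
  + n * (+ n) ^ e    ≡⟨ ℤP.*-comm (+ n) _ ⟩
  (+ n) ^ e * + n    ≡⟨ ^-suc (+ n) e ⟨
  (+ n) ^ suc e      ∎
  where open ≡-Reasoning

geometric-sum : ℤ → ℕ → ℤ
geometric-sum x e = ∑[ i < e ] (x ^ toℕ i)

geometric-series : ∀ x e → (1ℤ - x) * geometric-sum x e ≡ 1ℤ - x ^ e
geometric-series x zero    = solve (x ∷ [])
geometric-series x (suc e) = begin
  (1ℤ - x) * geometric-sum x (suc e)                 ≡⟨ cong ((1ℤ - x) *_) (∑-snoc e (x ^_)) ⟩
  (1ℤ - x) * (geometric-sum x e + x ^ e)             ≡⟨ ℤP.*-distribˡ-+ (1ℤ - x) _ (x ^ e) ⟩
  (1ℤ - x) * geometric-sum x e + (1ℤ - x) * x ^ e    ≡⟨ cong (_+ (1ℤ - x) * x ^ e) (geometric-series x e) ⟩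
  1ℤ - x ^ e + (1ℤ - x) * x ^ e                      ≡⟨ telescope x (x ^ e) ⟩
  1ℤ - x ^ e * x                                     ≡⟨ cong (λ z → 1ℤ - z) (^-suc x e) ⟨
  1ℤ - x ^ suc e                                     ∎
  where
  open ≡-Reasoning
  telescope : ∀ x y → 1ℤ - y + (1ℤ - x) * y ≡ 1ℤ - y * x
  telescope = solve-∀

geometric-sum-6 : ∀ y → geometric-sum y 6 ≡ 1ℤ + y + y ^ 2 + y ^ 3 + y ^ 4 + y ^ 5
geometric-sum-6 = unfolded
  where
  unfolded : ∀ y → y ^ 0 + (y ^ 1 + (y ^ 2 + (y ^ 3 + (y ^ 4 + (y ^ 5 + 0ℤ))))) ≡
                   1ℤ + y + y ^ 2 + y ^ 3 + y ^ 4 + y ^ 5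
  unfolded = solve-∀

*-geometric-sum : ∀ c u e → u * geometric-sum (c * u) e ≡ ∑[ i < e ] (c ^ toℕ i * u ^ suc (toℕ i))
*-geometric-sum c u e = trans (*-distribˡ-sum {e} u (λ i → (c * u) ^ toℕ i)) (sum-cong-≗ {e} λ i → begin
  u * (c * u) ^ toℕ i           ≡⟨ cong (u *_) (^-distrib-* c u (toℕ i)) ⟩
  u * (c ^ toℕ i * u ^ toℕ i)   ≡⟨ rotate u (c ^ toℕ i) (u ^ toℕ i) ⟩
  c ^ toℕ i * (u ^ toℕ i * u)   ≡⟨ cong (c ^ toℕ i *_) (^-suc u (toℕ i)) ⟨
  c ^ toℕ i * u ^ suc (toℕ i)   ∎)
  where
  open ≡-Reasoning
  rotate : ∀ a b c → a * (b * c) ≡ b * (c * a)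
  rotate = solve-∀

-- Inverses modulo an integer

record Invertible (m a : ℤ) : Set where
  constructor _,_
  field
    inverse     : ℤ
    a*inverse≡1 : a * inverse ≡ 1ℤ [modℤ m ]

module _ {m : ℤ} where

  inverse-unique : ∀ {a v w} → a * v ≡ 1ℤ [modℤ m ] → a * w ≡ 1ℤ [modℤ m ] → v ≡ w [modℤ m ]
  inverse-unique {a} {v} {w} (modℤ m∣av-1) (modℤ m∣aw-1) =
    modℤ (∣-respʳ (∣m∣n⇒∣m+n (∣n⇒∣m*n w m∣av-1) (∣m⇒∣-m (∣n⇒∣m*n v m∣aw-1))) (solve (a ∷ v ∷ w ∷ [])))

  invertible-* : ∀ {a b} → Invertible m a → Invertible m b → Invertible m (a * b)
  invertible-* {a} {b} (v , modℤ m∣av-1) (w , modℤ m∣bw-1) =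
    v * w , modℤ (∣-respʳ (∣m∣n⇒∣m+n (∣m⇒∣m*n (b * w) m∣av-1) m∣bw-1) (solve (a ∷ b ∷ v ∷ w ∷ [])))

  invertible-factor : ∀ {a b} → Invertible m (a * b) → Invertible m a
  invertible-factor {a} {b} (v , modℤ m∣abv-1) = b * v , modℤ (∣-respʳ m∣abv-1 (solve (a ∷ b ∷ v ∷ [])))

  invertible-cancel : ∀ {a x} → Invertible m a → m ∣ x * a → m ∣ x
  invertible-cancel {a} {x} (v , modℤ m∣av-1) m∣xa =
    ∣-respʳ (∣m∣n⇒∣m+n (∣m⇒∣m*n v m∣xa) (∣m⇒∣-m (∣n⇒∣m*n x m∣av-1))) (solve (a ∷ x ∷ v ∷ []))

-- If a v ≡ 1 mod m and a w ≡ 1 mod n then 1 − a (v + w − a v w) = (1 − a v)(1 − a w).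
invertible-lift : ∀ {m n a} → Invertible m a → Invertible n a → Invertible (m * n) a
invertible-lift {a = a} (v , modℤ m∣av-1) (w , modℤ n∣aw-1) =
  v + w - a * v * w , modℤ (∣-respʳ (∣m⇒∣-m (*-cong-∣ m∣av-1 n∣aw-1)) (solve (a ∷ v ∷ w ∷ [])))

invertible-^ : ∀ {m a} → Invertible m a → ∀ e → Invertible (m ^ e) a
invertible-^ {a = a} _ zero    = 0ℤ , modℤ (divides (a * 0ℤ - 1ℤ) (solve (a ∷ [])))
invertible-^ inv (suc zero)    = inv
invertible-^ inv (suc (suc e)) = invertible-lift (invertible-^ inv (suc e)) inv

private
  1+ab≡cd⇒ℤ : ∀ a b c d → 1 ℕ.+ a ℕ.* b ≡ c ℕ.* d → 1ℤ + + a * + b ≡ + c * + d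
  1+ab≡cd⇒ℤ a b c d eq = begin
    1ℤ + + a * + b     ≡⟨ cong (λ z → 1ℤ + z) (ℤP.pos-* a b) ⟨
    + (1 ℕ.+ a ℕ.* b)  ≡⟨ cong +_ eq ⟩
    + (c ℕ.* d)        ≡⟨ ℤP.pos-* c d ⟩
    + c * + d          ∎
    where open ≡-Reasoning

coprime⇒invertible : ∀ {m n} → Coprime m n → Invertible (+ m) (+ n)
coprime⇒invertible {m} {n} coprime with coprime-Bézout coprime
... | Bézout.+- x y 1+yn≡xm =
  - + y , modℤ (divides (- + x) (rearrange (+ n) (+ y) (+ x) (+ m) (1+ab≡cd⇒ℤ y n x m 1+yn≡xm)))
  where
  rearrange : ∀ N Y X M → 1ℤ + Y * N ≡ X * M → N * - Y - 1ℤ ≡ - X * M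
  rearrange N Y X M eq = begin
    N * - Y - 1ℤ    ≡⟨ solve (N ∷ Y ∷ []) ⟩
    - (1ℤ + Y * N)  ≡⟨ cong -_ eq ⟩
    - (X * M)       ≡⟨ solve (X ∷ M ∷ []) ⟩
    - X * M         ∎
    where open ≡-Reasoning
... | Bézout.-+ x y 1+xm≡yn =
  + y , modℤ (divides (+ x) (rearrange (+ n) (+ y) (+ x) (+ m) (1+ab≡cd⇒ℤ x m y n 1+xm≡yn)))
  where
  rearrange : ∀ N Y X M → 1ℤ + X * M ≡ Y * N → N * Y - 1ℤ ≡ X * M
  rearrange N Y X M eq = begin
    N * Y - 1ℤ       ≡⟨ solve (N ∷ Y ∷ []) ⟩
    Y * N - 1ℤ       ≡⟨ cong (_- 1ℤ) eq ⟨
    1ℤ + X * M - 1ℤ  ≡⟨ solve (X ∷ M ∷ []) ⟩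
    X * M            ∎
    where open ≡-Reasoning

prime∤⇒coprime : ∀ {p n} → Prime p → ¬ p ∣ℕ n → Coprime p n
prime∤⇒coprime p-prime p∤n (d∣p , d∣n) with prime⇒irreducible p-prime d∣p
... | inj₁ d≡1  = d≡1
... | inj₂ refl = contradiction d∣n p∤n

-- (a + t m) u ≡ 1 − y, and (1 − y)(1 + y + … + y ^ (e − 1)) = 1 − y ^ e with m ^ e ∣ y ^ e.
inverse-shift : ∀ m e a u t → a * u ≡ 1ℤ [modℤ m ^ e ] →
                (a + t * m) * (u * geometric-sum (- m * t * u) e) ≡ 1ℤ [modℤ m ^ e ]
inverse-shift m e a u t au≡1 = begin
  (a + t * m) * (u * G)         ≡⟨ expand a t m u G ⟩
  a * u * G + t * m * u * G     ≈⟨ +-cong-modℤ (*-cong-modℤ au≡1 ≡-modℤ-refl) ≡-modℤ-refl ⟩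
  1ℤ * G + t * m * u * G        ≡⟨ collect t m u G ⟩
  (1ℤ - y) * G                  ≡⟨ geometric-series y e ⟩
  1ℤ - y ^ e                    ≡⟨ cong (λ z → 1ℤ - z ^ e) (regroup t m u) ⟩
  1ℤ - (- (t * u) * m) ^ e      ≡⟨ cong (λ z → 1ℤ - z) (^-distrib-* (- (t * u)) m e) ⟩
  1ℤ - (- (t * u)) ^ e * m ^ e  ≈⟨ x-km≡x 1ℤ ((- (t * u)) ^ e) ⟩
  1ℤ                            ∎
  where
  open ≡-modℤ-Reasoning (m ^ e)
  y = - m * t * u
  G = geometric-sum y e
  expand : ∀ a t m u G → (a + t * m) * (u * G) ≡ a * u * G + t * m * u * G
  expand = solve-∀
  collect : ∀ t m u G → 1ℤ * G + t * m * u * G ≡ (1ℤ - - m * t * u) * G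
  collect = solve-∀
  regroup : ∀ t m u → - m * t * u ≡ - (t * u) * m
  regroup = solve-∀

≡-mod-residue : ∀ x d .{{_ : ℕ.NonZero d}} → x ≡ + (x %ℕ d) [modℤ + d ]
≡-mod-residue x d = modℤ (divides (x /ℕ d) (begin
  x - + (x %ℕ d)                            ≡⟨ cong (_- + (x %ℕ d)) (a≡a%ℕn+[a/ℕn]*n x d) ⟩
  + (x %ℕ d) + (x /ℕ d) * + d - + (x %ℕ d)  ≡⟨ cancel (+ (x %ℕ d)) (x /ℕ d * + d) ⟩
  x /ℕ d * + d                              ∎))
  where
  open ≡-Reasoning
  cancel : ∀ r y → r + y - r ≡ y
  cancel = solve-∀

private
  residue-injective-≤ : ∀ {d r s} → r ≤ s → s < d → + s ≡ + r [modℤ + d ] → s ≡ r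
  residue-injective-≤ {d} {r} {s} r≤s s<d (modℤ d∣s-r)
    with s ∸ r in s∸r≡ | ∣⇒∣ᵤ (∣-respʳ d∣s-r (trans (ℤP.[+m]-[+n]≡m⊖n s r) (ℤP.⊖-≥ r≤s)))
  ... | zero  | _     = ℕP.≤-antisym (ℕP.m∸n≡0⇒m≤n s∸r≡) r≤s
  ... | suc _ | d∣s∸r = contradiction d∣s∸r (>⇒∤ (subst (_< d) s∸r≡ (ℕP.≤-<-trans (ℕP.m∸n≤m s r) s<d)))

residue-injective : ∀ {d r s} → r < d → s < d → + r ≡ + s [modℤ + d ] → r ≡ s
residue-injective r<d s<d r≡s with ℕP.≤-total _ _
... | inj₁ r≤s = sym (residue-injective-≤ r≤s s<d (≡-modℤ-sym r≡s))
... | inj₂ s≤r = residue-injective-≤ s≤r r<d r≡s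

-- Reduction of rationals modulo an integer

infix 4 _↦_[modℤ_]

record _↦_[modℤ_] (x : ℚ) (r m : ℤ) : Set where
  constructor reduction
  field
    ↧-invertible : Invertible m (↧ x)
    ↥≡           : ↥ x ≡ r * ↧ x [modℤ m ]

module _ {m : ℤ} where

  ↦-/ : ∀ {r} i n .{{_ : ℕ.NonZero n}} → Invertible m (+ n) → i ≡ r * + n [modℤ m ] →
        i ℚ./ n ↦ r [modℤ m ]
  ↦-/ {r} i n invertible-n (modℤ m∣i-rn) = reduction
    (invertible-factor invertible-↧g)
    (modℤ (invertible-cancel invertible-g (∣-respʳ m∣i-rn i-rn≡[↥-r↧]g)))
    where
    x = i ℚ./ n
    g = gcd i (+ n)
    invertible-↧g : Invertible m (↧ x * g)
    invertible-↧g = subst (Invertible m) (sym (ℚP.↧-/ i n)) invertible-n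
    invertible-g : Invertible m g
    invertible-g = invertible-factor (subst (Invertible m) (ℤP.*-comm (↧ x) g) invertible-↧g)
    i-rn≡[↥-r↧]g : i - r * + n ≡ (↥ x - r * ↧ x) * g
    i-rn≡[↥-r↧]g = begin
      i - r * + n              ≡⟨ cong₂ (λ a b → a - r * b) (ℚP.↥-/ i n) (ℚP.↧-/ i n) ⟨
      ↥ x * g - r * (↧ x * g)  ≡⟨ factor (↥ x) r (↧ x) g ⟩
      (↥ x - r * ↧ x) * g      ∎
      where
      open ≡-Reasoning
      factor : ∀ a r d g → a * g - r * (d * g) ≡ (a - r * d) * g
      factor = solve-∀

  ↦-resp : ∀ {x r s} → x ↦ r [modℤ m ] → r ≡ s [modℤ m ] → x ↦ s [modℤ m ]
  ↦-resp (reduction invertible ↥≡) r≡s =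
    reduction invertible (≡-modℤ-trans ↥≡ (*-cong-modℤ r≡s ≡-modℤ-refl))

  ↦-+ : ∀ x y {r s} → x ↦ r [modℤ m ] → y ↦ s [modℤ m ] → x ℚ.+ y ↦ r + s [modℤ m ]
  ↦-+ x@record{} y@record{} {r} {s} (reduction inv-x ↥x≡) (reduction inv-y ↥y≡) =
    ↦-/ (↥ x * ↧ y + ↥ y * ↧ x) (↧ₙ x ℕ.* ↧ₙ y)
      (subst (Invertible m) (sym (ℤP.pos-* (↧ₙ x) (↧ₙ y))) (invertible-* inv-x inv-y))
      (≡-modℤ-trans (+-cong-modℤ (*-cong-modℤ ↥x≡ ≡-modℤ-refl) (*-cong-modℤ ↥y≡ ≡-modℤ-refl))
        (≡⇒≡-modℤ (trans (collect r s (↧ x) (↧ y)) (cong ((r + s) *_) (sym (ℤP.pos-* (↧ₙ x) (↧ₙ y)))))))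
    where
    collect : ∀ r s a b → r * a * b + s * b * a ≡ (r + s) * (a * b)
    collect = solve-∀

  ↦-* : ∀ x y {r s} → x ↦ r [modℤ m ] → y ↦ s [modℤ m ] → x ℚ.* y ↦ r * s [modℤ m ]
  ↦-* x@record{} y@record{} {r} {s} (reduction inv-x ↥x≡) (reduction inv-y ↥y≡) =
    ↦-/ (↥ x * ↥ y) (↧ₙ x ℕ.* ↧ₙ y)
      (subst (Invertible m) (sym (ℤP.pos-* (↧ₙ x) (↧ₙ y))) (invertible-* inv-x inv-y))
      (≡-modℤ-trans (*-cong-modℤ ↥x≡ ↥y≡)
        (≡⇒≡-modℤ (trans (collect r s (↧ x) (↧ y)) (cong ((r * s) *_) (sym (ℤP.pos-* (↧ₙ x) (↧ₙ y)))))))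
    where
    collect : ∀ r s a b → r * a * (s * b) ≡ (r * s) * (a * b)
    collect = solve-∀

  ↦-neg : ∀ {x r} → x ↦ r [modℤ m ] → ℚ.- x ↦ - r [modℤ m ]
  ↦-neg {x} {r} (reduction inv-x ↥x≡) = reduction
    (subst (Invertible m) (sym (ℚP.↧-neg x)) inv-x)
    (subst₂ (λ a b → a ≡ - r * b [modℤ m ]) (sym (ℚP.↥-neg x)) (sym (ℚP.↧-neg x))
      (≡-modℤ-trans (neg-cong-modℤ ↥x≡) (≡⇒≡-modℤ (ℤP.neg-distribˡ-* r (↧ x)))))

  ↦-0 : 0ℚ ↦ 0ℤ [modℤ m ]
  ↦-0 = reduction (1ℤ , ≡-modℤ-refl) ≡-modℤ-refl

  ↦-integer : ∀ k → + k ℚ./ 1 ↦ + k [modℤ m ]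
  ↦-integer k = ↦-/ (+ k) 1 (1ℤ , ≡-modℤ-refl) (≡⇒≡-modℤ (sym (ℤP.*-identityʳ (+ k))))

  ↦-recip : ∀ n r → + suc n * r ≡ 1ℤ [modℤ m ] → recip (suc n) ↦ r [modℤ m ]
  ↦-recip n r nr≡1 = ↦-/ 1ℤ (suc n) (r , nr≡1)
    (≡-modℤ-sym (≡-modℤ-trans (≡⇒≡-modℤ (ℤP.*-comm r (+ suc n))) nr≡1))

  ↦-same⇒∣↥- : ∀ {x y r} → x ↦ r [modℤ m ] → y ↦ r [modℤ m ] → m ∣ ↥ (x ℚ.- y)
  ↦-same⇒∣↥- {x} {y} {r} x↦r y↦r =
    ∣-respʳ (_≡_[modℤ_].m∣x-y (_↦_[modℤ_].↥≡ x-y↦0)) (cancel (↥ (x ℚ.- y)) (↧ (x ℚ.- y)))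
    where
    x-y↦0 : x ℚ.- y ↦ 0ℤ [modℤ m ]
    x-y↦0 = ↦-resp (↦-+ x (ℚ.- y) x↦r (↦-neg y↦r)) (≡⇒≡-modℤ (ℤP.+-inverseʳ r))
    cancel : ∀ a d → a - 0ℤ * d ≡ a
    cancel = solve-∀

  ↦-H-step : ∀ n {r} s → H n ↦ r [modℤ m ] → + suc n * s ≡ 1ℤ [modℤ m ] →
             H (suc n) ↦ r + s [modℤ m ]
  ↦-H-step n s H↦r s-inverse = ↦-+ (H n) (recip (suc n)) H↦r (↦-recip n s s-inverse)

  ↦-Hcoprime-step : ∀ {p n r} s → ¬ p ∣ℕ suc n → Hcoprime p n ↦ r [modℤ m ] →
                    + suc n * s ≡ 1ℤ [modℤ m ] → Hcoprime p (suc n) ↦ r + s [modℤ m ]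
  ↦-Hcoprime-step {p} {n} s p∤ H↦r s-inverse with p ∣? suc n
  ... | yes p∣ = contradiction p∣ p∤
  ... | no _   = ↦-+ (Hcoprime p n) (recip (suc n)) H↦r (↦-recip n s s-inverse)

  ↦-Hcoprime-skip : ∀ {p n r} → p ∣ℕ suc n → Hcoprime p n ↦ r [modℤ m ] →
                    Hcoprime p (suc n) ↦ r [modℤ m ]
  ↦-Hcoprime-skip {p} {n} p∣ H↦r with p ∣? suc n
  ... | yes _ = H↦r
  ... | no p∤ = contradiction p∣ p∤

-- faulhaber i N = 60 (0 ^ i + 1 ^ i + … + (N − 1) ^ i)
faulhaber : Fin 6 → ℤ → ℤ
faulhaber 0F N = 60 * N
faulhaber 1F N = 30 * N * (N - 1)
faulhaber 2F N = 10 * N * (N - 1) * (2 * N - 1)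
faulhaber 3F N = 15 * N ^ 2 * (N - 1) ^ 2
faulhaber 4F N = 2 * N * (N - 1) * (2 * N - 1) * (3 * N ^ 2 - 3 * N - 1)
faulhaber 5F N = 5 * N ^ 2 * (N - 1) ^ 2 * (2 * N ^ 2 - 2 * N - 1)

faulhaber-step : ∀ i N → faulhaber i (1ℤ + N) ≡ faulhaber i N + 60 * N ^ toℕ i
faulhaber-step 0F = step
  where step : ∀ N → 60 * (1ℤ + N) ≡ 60 * N + 60 * N ^ 0
        step = solve-∀
faulhaber-step 1F = step
  where step : ∀ N → 30 * (1ℤ + N) * (1ℤ + N - 1) ≡ 30 * N * (N - 1) + 60 * N ^ 1
        step = solve-∀
faulhaber-step 2F = step
  where step : ∀ N → 10 * (1ℤ + N) * (1ℤ + N - 1) * (2 * (1ℤ + N) - 1) ≡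
                     10 * N * (N - 1) * (2 * N - 1) + 60 * N ^ 2
        step = solve-∀
faulhaber-step 3F = step
  where step : ∀ N → 15 * (1ℤ + N) ^ 2 * (1ℤ + N - 1) ^ 2 ≡ 15 * N ^ 2 * (N - 1) ^ 2 + 60 * N ^ 3
        step = solve-∀
faulhaber-step 4F = step
  where step : ∀ N → 2 * (1ℤ + N) * (1ℤ + N - 1) * (2 * (1ℤ + N) - 1) *
                     (3 * (1ℤ + N) ^ 2 - 3 * (1ℤ + N) - 1) ≡
                     2 * N * (N - 1) * (2 * N - 1) * (3 * N ^ 2 - 3 * N - 1) + 60 * N ^ 4
        step = solve-∀
faulhaber-step 5F = step
  where step : ∀ N → 5 * (1ℤ + N) ^ 2 * (1ℤ + N - 1) ^ 2 * (2 * (1ℤ + N) ^ 2 - 2 * (1ℤ + N) - 1) ≡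
                     5 * N ^ 2 * (N - 1) ^ 2 * (2 * N ^ 2 - 2 * N - 1) + 60 * N ^ 5
        step = solve-∀

faulhaber-0 : ∀ i → faulhaber i 0ℤ ≡ 0ℤ
faulhaber-0 0F = refl
faulhaber-0 1F = refl
faulhaber-0 2F = refl
faulhaber-0 3F = refl
faulhaber-0 4F = refl
faulhaber-0 5F = refl

power-sum-formula : ∀ i n → 60 * ∑[ k < n ] ((+ toℕ k) ^ toℕ i) ≡ faulhaber i (+ n)
power-sum-formula i n = trans (*-distribˡ-sum {n} 60 (λ k → (+ toℕ k) ^ toℕ i))
  (∑-telescope (faulhaber i ∘ +_) (λ k → 60 * (+ k) ^ toℕ i) (faulhaber-0 i) (faulhaber-step i ∘ +_) n)

-- With 60 Sᵢ replaced by Faulhaber's polynomial, 60 (Σᵢ (− P)ⁱ Sᵢ Bᵢ₊₁ − P² B₁) is a combination of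
-- the three reflection relations, of B₄ and of P⁶.
sixty-combination : ∀ P B₁ B₂ B₃ B₄ B₅ B₆ →
  (- P) ^ 0 * B₁ * (60 * P) + ((- P) ^ 1 * B₂ * (30 * P * (P - 1)) +
  ((- P) ^ 2 * B₃ * (10 * P * (P - 1) * (2 * P - 1)) + ((- P) ^ 3 * B₄ * (15 * P ^ 2 * (P - 1) ^ 2) +
  ((- P) ^ 4 * B₅ * (2 * P * (P - 1) * (2 * P - 1) * (3 * P ^ 2 - 3 * P - 1)) +
  ((- P) ^ 5 * B₆ * (5 * P ^ 2 * (P - 1) ^ 2 * (2 * P ^ 2 - 2 * P - 1)) + 0ℤ))))) - 60 * (P ^ 2 * B₁)
  ≡ (30 * P - 30 * P ^ 2) * (2 * B₁ + P * B₂ + P ^ 2 * B₃ + P ^ 3 * B₄ + P ^ 4 * B₅ + P ^ 5 * B₆)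
    + (10 * P ^ 2 - 10) * (P ^ 3 * (2 * B₃ + 3 * P * B₄ + 6 * P ^ 2 * B₅))
    + (14 + 15 * P - 20 * P ^ 2 - 15 * P ^ 3 + 6 * P ^ 4) * (P ^ 5 * (2 * B₅))
    + (15 - 15 * P ^ 2) * (P ^ 5 * B₄)
    + (35 * P - 30 - 25 * P ^ 3 + 30 * P ^ 4 - 10 * P ^ 5) * B₆ * P ^ 6
sixty-combination = solve-∀

module _ (q : ℕ) (p-prime : Prime (suc q)) (7≤p : 7 ≤ suc q) where

  private
    p : ℕ
    p = suc q

    P P⁶ : ℤ
    P  = + p
    P⁶ = P ^ 6

  p∤suc : ∀ {a} → a < q → ¬ p ∣ℕ suc a
  p∤suc a<q = >⇒∤ (s≤s a<q)

  invertible-mod-P^ : ∀ {n} → ¬ p ∣ℕ n → ∀ e → Invertible (P ^ e) (+ n)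
  invertible-mod-P^ p∤n = invertible-^ (coprime⇒invertible (prime∤⇒coprime p-prime p∤n))

  -- u a is the inverse of a + 1 modulo p⁶ when a < q, and 0 otherwise. It is opaque so that the
  -- Bézout computation behind it is never unfolded during type checking.
  opaque
    u : ℕ → ℤ
    u a with a ℕ.<? q
    ... | yes a<q = Invertible.inverse (invertible-mod-P^ (p∤suc a<q) 6)
    ... | no _    = 0ℤ

    u-inverse : ∀ {a} → a < q → + suc a * u a ≡ 1ℤ [modℤ P⁶ ]
    u-inverse {a} a<q with a ℕ.<? q
    ... | yes a<q′ = Invertible.a*inverse≡1 (invertible-mod-P^ (p∤suc a<q′) 6)
    ... | no a≮q   = contradiction a<q a≮q

  B : ℕ → ℤ
  B e = ∑[ a < q ] (u (toℕ a) ^ e)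

  S : ℕ → ℤ
  S e = ∑[ k < p ] ((+ toℕ k) ^ e)

  -- Splitting 1, …, p² into blocks

  U : ℕ → ℕ → ℤ
  U k a = u a * geometric-sum (- P * + k * u a) 6

  U-inverse : ∀ k {a} → a < q → + suc (k ℕ.* p ℕ.+ a) * U k a ≡ 1ℤ [modℤ P⁶ ]
  U-inverse k {a} a<q = subst (λ n → n * U k a ≡ 1ℤ [modℤ P⁶ ]) (sym cast)
    (inverse-shift P 6 (+ suc a) (u a) (+ k) (u-inverse a<q))
    where
    cast : + suc (k ℕ.* p ℕ.+ a) ≡ + suc a + + k * P
    cast = begin
      1ℤ + + (k ℕ.* p ℕ.+ a)    ≡⟨ cong (λ z → 1ℤ + z) (ℤP.pos-+ (k ℕ.* p) a) ⟩
      1ℤ + (+ (k ℕ.* p) + + a)  ≡⟨ cong (λ z → 1ℤ + (z + + a)) (ℤP.pos-* k p) ⟩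
      1ℤ + (+ k * P + + a)      ≡⟨ shuffle (+ k * P) (+ a) ⟩
      1ℤ + + a + + k * P        ∎
      where
      open ≡-Reasoning
      shuffle : ∀ x y → 1ℤ + (x + y) ≡ 1ℤ + y + x
      shuffle = solve-∀

  block : ℕ → ℤ
  block k = ∑[ a < q ] U k (toℕ a)

  blocks : ℕ → ℤ
  blocks k = ∑[ i < k ] block (toℕ i)

  ↦-Hcoprime-blocks : ∀ k → Hcoprime p (k ℕ.* p) ↦ blocks k [modℤ P⁶ ]

  ↦-Hcoprime-partial : ∀ k j → j ≤ q →
    Hcoprime p (k ℕ.* p ℕ.+ j) ↦ blocks k + ∑[ a < j ] U k (toℕ a) [modℤ P⁶ ]
  ↦-Hcoprime-partial k zero _ rewrite ℕP.+-identityʳ (k ℕ.* p) =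
    ↦-resp (↦-Hcoprime-blocks k) (≡⇒≡-modℤ (sym (ℤP.+-identityʳ (blocks k))))
  ↦-Hcoprime-partial k (suc j) j<q =
    subst (λ n → Hcoprime p n ↦ blocks k + ∑[ a < suc j ] U k (toℕ a) [modℤ P⁶ ])
      (sym (ℕP.+-suc (k ℕ.* p) j))
      (↦-resp (↦-Hcoprime-step (U k j) p∤ (↦-Hcoprime-partial k j (ℕP.<⇒≤ j<q)) (U-inverse k j<q))
        (≡⇒≡-modℤ (trans (ℤP.+-assoc (blocks k) _ (U k j))
                         (cong (λ z → blocks k + z) (sym (∑-snoc j (U k)))))))
    where
    p∤ : ¬ p ∣ℕ suc (k ℕ.* p ℕ.+ j)
    p∤ p∣ = p∤suc j<q (∣m+n∣m⇒∣n (subst (p ∣ℕ_) (sym (ℕP.+-suc _ j)) p∣) (n∣m*n k))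

  ↦-Hcoprime-blocks zero    = ↦-0
  ↦-Hcoprime-blocks (suc k) = subst (λ n → Hcoprime p n ↦ blocks (suc k) [modℤ P⁶ ]) (sym last-block)
    (↦-Hcoprime-skip (subst (p ∣ℕ_) last-block (n∣m*n (suc k)))
      (↦-resp (↦-Hcoprime-partial k q ℕP.≤-refl) (≡⇒≡-modℤ (sym (∑-snoc k block)))))
    where
    last-block : suc k ℕ.* p ≡ suc (k ℕ.* p ℕ.+ q)
    last-block = trans (ℕP.+-comm p (k ℕ.* p)) (ℕP.+-suc (k ℕ.* p) q)

  ↦-H : ∀ j → j ≤ q → H j ↦ ∑[ a < j ] u (toℕ a) [modℤ P⁶ ]
  ↦-H zero    _   = ↦-0
  ↦-H (suc j) j<q = ↦-resp (↦-H-step j (u j) (↦-H j (ℕP.<⇒≤ j<q)) (u-inverse j<q))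
    (≡⇒≡-modℤ (sym (∑-snoc j u)))

  expansion : ℤ
  expansion = ∑[ i < 6 ] ((- P) ^ toℕ i * B (suc (toℕ i)) * S (toℕ i))

  block-expansion : ∀ k → block k ≡ ∑[ i < 6 ] ((- P * + k) ^ toℕ i * B (suc (toℕ i)))
  block-expansion k =
    trans (sum-cong-≗ {q} (λ a → *-geometric-sum (- P * + k) (u (toℕ a)) 6))
          (∑-∑-scale {6} {q} (λ i → (- P * + k) ^ toℕ i) (λ i a → u (toℕ a) ^ suc (toℕ i)))

  blocks≡expansion : blocks p ≡ expansion
  blocks≡expansion = begin
    ∑[ k < p ] block (toℕ k)
      ≡⟨ sum-cong-≗ {p} (block-expansion ∘ toℕ) ⟩
    ∑[ k < p ] ∑[ i < 6 ] ((- P * + toℕ k) ^ toℕ i * B (suc (toℕ i)))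
      ≡⟨ sum-cong-≗ {p} (λ k → sum-cong-≗ {6} (λ i → split (+ toℕ k) (toℕ i) (B (suc (toℕ i))))) ⟩
    ∑[ k < p ] ∑[ i < 6 ] ((- P) ^ toℕ i * B (suc (toℕ i)) * (+ toℕ k) ^ toℕ i)
      ≡⟨ ∑-∑-scale {6} {p} (λ i → (- P) ^ toℕ i * B (suc (toℕ i))) (λ i k → (+ toℕ k) ^ toℕ i) ⟩
    expansion
      ∎
    where
    open ≡-Reasoning
    split : ∀ K i b → (- P * K) ^ i * b ≡ (- P) ^ i * b * K ^ i
    split K i b = trans (cong (_* b) (^-distrib-* (- P) K i)) (swap ((- P) ^ i) (K ^ i) b)
      where
      swap : ∀ x y z → x * y * z ≡ x * z * y
      swap = solve-∀

  -- Pairing a with p − a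

  P∣P⁶ : P ∣ P⁶
  P∣P⁶ = divides (P ^ 5) (^-suc P 5)

  P³∣P⁶ : P ^ 3 ∣ P⁶
  P³∣P⁶ = divides (P ^ 3) (^-homo-* P 3 3)

  u-inverse-mod-P : ∀ {a} → a < q → + suc a * u a ≡ 1ℤ [modℤ P ]
  u-inverse-mod-P a<q = ≡-modℤ-weaken P∣P⁶ (u-inverse a<q)

  reflect : ℤ → ℤ
  reflect x = - (x * geometric-sum (P * x) 6)

  -- p − a = − a + p, and − u a inverts − a.
  u-opposite : ∀ {a} → a < q → u (q ∸ suc a) ≡ reflect (u a) [modℤ P⁶ ]
  u-opposite {a} a<q = inverse-unique {a = + suc (q ∸ suc a)} (u-inverse (ℕP.∸-monoʳ-< (s≤s z≤n) a<q))
    (subst₂ (λ n r → n * r ≡ 1ℤ [modℤ P⁶ ]) (sym opposite≡) (sym reflect≡)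
      (inverse-shift P 6 (- + suc a) (- u a) 1ℤ
        (≡-modℤ-trans (≡⇒≡-modℤ (neg-*-neg (+ suc a) (u a))) (u-inverse a<q))))
    where
    neg-*-neg : ∀ x y → - x * - y ≡ x * y
    neg-*-neg = solve-∀
    opposite≡ : + suc (q ∸ suc a) ≡ - + suc a + 1ℤ * P
    opposite≡ = begin
      + suc (q ∸ suc a)                          ≡⟨ cancel (+ suc (q ∸ suc a)) (+ suc a) ⟩
      - + suc a + (+ suc (q ∸ suc a) + + suc a)
        ≡⟨ cong (λ n → - + suc a + n) (ℤP.pos-+ (suc (q ∸ suc a)) (suc a)) ⟨
      - + suc a + + (suc (q ∸ suc a) ℕ.+ suc a)  ≡⟨ cong (λ n → - + suc a + + suc n) (ℕP.m∸n+n≡m a<q) ⟩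
      - + suc a + P                              ≡⟨ cong (λ n → - + suc a + n) (ℤP.*-identityˡ P) ⟨
      - + suc a + 1ℤ * P                         ∎
      where
      open ≡-Reasoning
      cancel : ∀ x y → x ≡ - y + (x + y)
      cancel = solve-∀
    reflect≡ : reflect (u a) ≡ - u a * geometric-sum (- P * 1ℤ * - u a) 6
    reflect≡ = trans (ℤP.neg-distribˡ-* (u a) _) (cong (λ y → - u a * geometric-sum y 6) (twist P (u a)))
      where
      twist : ∀ P x → P * x ≡ - P * 1ℤ * - x
      twist = solve-∀

  B-reflection : ∀ e → B e ≡ ∑[ a < q ] (reflect (u (toℕ a)) ^ e) [modℤ P⁶ ]
  B-reflection e = begin
    B e
      ≡⟨ sum-permute {q} {q} (λ a → u (toℕ a) ^ e) reverse ⟩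
    ∑[ a < q ] (u (toℕ (Fin.opposite a)) ^ e)
      ≡⟨ sum-cong-≗ {q} (cong (λ n → u n ^ e) ∘ FinP.opposite-prop) ⟩
    ∑[ a < q ] (u (q ∸ suc (toℕ a)) ^ e)
      ≈⟨ ∑-cong-modℤ (λ a → ^-cong-modℤ e (u-opposite (FinP.toℕ<n a))) ⟩
    ∑[ a < q ] (reflect (u (toℕ a)) ^ e)
      ∎
    where open ≡-modℤ-Reasoning P⁶

  relation-B₁ : P⁶ ∣ 2 * B 1 + P * B 2 + P ^ 2 * B 3 + P ^ 3 * B 4 + P ^ 4 * B 5 + P ^ 5 * B 6
  relation-B₁ = ∣-respʳ (_≡_[modℤ_].m∣x-y B₁≡) (rearrange P (B 1) (B 2) (B 3) (B 4) (B 5) (B 6))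
    where
    B₁≡ : B 1 ≡ - ∑[ i < 6 ] (P ^ toℕ i * B (suc (toℕ i))) [modℤ P⁶ ]
    B₁≡ = begin
      B 1
        ≈⟨ B-reflection 1 ⟩
      ∑[ a < q ] reflect (u (toℕ a))
        ≡⟨ ∑-neg {q} (λ a → u (toℕ a) * geometric-sum (P * u (toℕ a)) 6) ⟩
      - ∑[ a < q ] (u (toℕ a) * geometric-sum (P * u (toℕ a)) 6)
        ≡⟨ cong -_ (sum-cong-≗ {q} (λ a → *-geometric-sum P (u (toℕ a)) 6)) ⟩
      - ∑[ a < q ] ∑[ i < 6 ] (P ^ toℕ i * u (toℕ a) ^ suc (toℕ i))
        ≡⟨ cong -_ (∑-∑-scale {6} {q} (λ i → P ^ toℕ i) (λ i a → u (toℕ a) ^ suc (toℕ i))) ⟩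
      - ∑[ i < 6 ] (P ^ toℕ i * B (suc (toℕ i)))
        ∎
      where open ≡-modℤ-Reasoning P⁶
    rearrange : ∀ P B₁ B₂ B₃ B₄ B₅ B₆ →
      B₁ - - (P ^ 0 * B₁ + (P ^ 1 * B₂ + (P ^ 2 * B₃ + (P ^ 3 * B₄ + (P ^ 4 * B₅ + (P ^ 5 * B₆ + 0ℤ)))))) ≡
      2 * B₁ + P * B₂ + P ^ 2 * B₃ + P ^ 3 * B₄ + P ^ 4 * B₅ + P ^ 5 * B₆
    rearrange = solve-∀

  cube-coefficient : Fin 3 → ℤ
  cube-coefficient 0F = 1ℤ
  cube-coefficient 1F = 3 * P
  cube-coefficient 2F = 6 * P ^ 2

  reflect-cube : ∀ x → reflect x ^ 3 ≡ - ∑[ i < 3 ] (cube-coefficient i * x ^ (3 ℕ.+ toℕ i)) [modℤ P ^ 3 ]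
  reflect-cube x = ≡-modℤ-trans (^-cong-modℤ 3 truncated)
    (modℤ (divides (- (7 * x ^ 6 + 6 * P * x ^ 7 + 3 * P ^ 2 * x ^ 8 + P ^ 3 * x ^ 9)) (cube P x)))
    where
    truncated : reflect x ≡ - (x + P * x ^ 2 + P ^ 2 * x ^ 3) [modℤ P ^ 3 ]
    truncated = modℤ (divides (- (x ^ 4 + P * x ^ 5 + P ^ 2 * x ^ 6))
      (trans (cong (λ g → - (x * g) - - (x + P * x ^ 2 + P ^ 2 * x ^ 3)) (geometric-sum-6 (P * x)))
             (cut P x)))
      where
      cut : ∀ P x → - (x * (1ℤ + P * x + (P * x) ^ 2 + (P * x) ^ 3 + (P * x) ^ 4 + (P * x) ^ 5)) -
                    - (x + P * x ^ 2 + P ^ 2 * x ^ 3) ≡ - (x ^ 4 + P * x ^ 5 + P ^ 2 * x ^ 6) * P ^ 3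
      cut = solve-∀
    cube : ∀ P x → (- (x + P * x ^ 2 + P ^ 2 * x ^ 3)) ^ 3 -
                   - (1ℤ * x ^ 3 + (3 * P * x ^ 4 + (6 * P ^ 2 * x ^ 5 + 0ℤ))) ≡
                   - (7 * x ^ 6 + 6 * P * x ^ 7 + 3 * P ^ 2 * x ^ 8 + P ^ 3 * x ^ 9) * P ^ 3
    cube = solve-∀

  relation-B₃ : P ^ 3 ∣ 2 * B 3 + 3 * P * B 4 + 6 * P ^ 2 * B 5
  relation-B₃ = ∣-respʳ (_≡_[modℤ_].m∣x-y B₃≡) (rearrange P (B 3) (B 4) (B 5))
    where
    B₃≡ : B 3 ≡ - ∑[ i < 3 ] (cube-coefficient i * B (3 ℕ.+ toℕ i)) [modℤ P ^ 3 ]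
    B₃≡ = begin
      B 3
        ≈⟨ ≡-modℤ-weaken P³∣P⁶ (B-reflection 3) ⟩
      ∑[ a < q ] (reflect (u (toℕ a)) ^ 3)
        ≈⟨ ∑-cong-modℤ {n = q} (reflect-cube ∘ u ∘ toℕ) ⟩
      ∑[ a < q ] (- ∑[ i < 3 ] (cube-coefficient i * u (toℕ a) ^ (3 ℕ.+ toℕ i)))
        ≡⟨ ∑-neg {q} (λ a → ∑[ i < 3 ] (cube-coefficient i * u (toℕ a) ^ (3 ℕ.+ toℕ i))) ⟩
      - ∑[ a < q ] ∑[ i < 3 ] (cube-coefficient i * u (toℕ a) ^ (3 ℕ.+ toℕ i))
        ≡⟨ cong -_ (∑-∑-scale {3} {q} cube-coefficient (λ i a → u (toℕ a) ^ (3 ℕ.+ toℕ i))) ⟩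
      - ∑[ i < 3 ] (cube-coefficient i * B (3 ℕ.+ toℕ i))
        ∎
      where open ≡-modℤ-Reasoning (P ^ 3)
    rearrange : ∀ P B₃ B₄ B₅ → B₃ - - (1ℤ * B₃ + (3 * P * B₄ + (6 * P ^ 2 * B₅ + 0ℤ))) ≡
                               2 * B₃ + 3 * P * B₄ + 6 * P ^ 2 * B₅
    rearrange = solve-∀

  reflect-fifth : ∀ x → reflect x ^ 5 ≡ - x ^ 5 [modℤ P ]
  reflect-fifth x = ≡-modℤ-trans (^-cong-modℤ 5 truncated) (≡⇒≡-modℤ (odd-power x))
    where
    truncated : reflect x ≡ - x [modℤ P ]
    truncated = modℤ (divides (- (x ^ 2 + P * x ^ 3 + P ^ 2 * x ^ 4 + P ^ 3 * x ^ 5 + P ^ 4 * x ^ 6))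
      (trans (cong (λ g → - (x * g) - - x) (geometric-sum-6 (P * x))) (cut P x)))
      where
      cut : ∀ P x → - (x * (1ℤ + P * x + (P * x) ^ 2 + (P * x) ^ 3 + (P * x) ^ 4 + (P * x) ^ 5)) - - x ≡
                    - (x ^ 2 + P * x ^ 3 + P ^ 2 * x ^ 4 + P ^ 3 * x ^ 5 + P ^ 4 * x ^ 6) * P
      cut = solve-∀
    odd-power : ∀ x → (- x) ^ 5 ≡ - x ^ 5
    odd-power = solve-∀

  relation-B₅ : P ∣ 2 * B 5
  relation-B₅ = ∣-respʳ (_≡_[modℤ_].m∣x-y B₅≡) (double (B 5))
    where
    B₅≡ : B 5 ≡ - B 5 [modℤ P ]
    B₅≡ = begin
      B 5                                   ≈⟨ ≡-modℤ-weaken P∣P⁶ (B-reflection 5) ⟩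
      ∑[ a < q ] (reflect (u (toℕ a)) ^ 5)  ≈⟨ ∑-cong-modℤ {n = q} (reflect-fifth ∘ u ∘ toℕ) ⟩
      ∑[ a < q ] (- u (toℕ a) ^ 5)          ≡⟨ ∑-neg {q} (λ a → u (toℕ a) ^ 5) ⟩
      - B 5                                 ∎
      where open ≡-modℤ-Reasoning P
    double : ∀ b → b - - b ≡ 2 * b
    double = solve-∀

  -- Inversion permutes the residues

  p∤<7 : ∀ {d} .{{_ : ℕ.NonZero d}} → d < 7 → ¬ p ∣ℕ d
  p∤<7 d<7 = >⇒∤ (ℕP.<-≤-trans d<7 7≤p)

  P∤1 : ¬ P ∣ 1ℤ
  P∤1 P∣1 = p∤<7 (from-yes (1 ℕ.<? 7)) (∣⇒∣ᵤ P∣1)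

  opaque
    residue : Fin q → ℕ
    residue a = u (toℕ a) %ℕ p

    residue<p : ∀ a → residue a < p
    residue<p a = n%ℕd<d (u (toℕ a)) p

    u≡residue : ∀ a → u (toℕ a) ≡ + residue a [modℤ P ]
    u≡residue a = ≡-mod-residue (u (toℕ a)) p

  residue-inverse : ∀ a → + suc (toℕ a) * + residue a ≡ 1ℤ [modℤ P ]
  residue-inverse a = ≡-modℤ-trans {y = + suc (toℕ a) * u (toℕ a)}
    (*-cong-modℤ {x = + suc (toℕ a)} ≡-modℤ-refl (≡-modℤ-sym (u≡residue a)))
    (u-inverse-mod-P (FinP.toℕ<n a))

  residue-positive : ∀ a → 0 < residue a
  residue-positive a = ℕP.n≢0⇒n>0 λ residue≡0 →
    P∤1 (∣-respʳ (∣m⇒∣-m (_≡_[modℤ_].m∣x-y (subst (λ r → + suc (toℕ a) * + r ≡ 1ℤ [modℤ P ]) residue≡0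
                                                     (residue-inverse a))))
                 (flip (+ suc (toℕ a))))
    where
    flip : ∀ x → - (x * 0ℤ - 1ℤ) ≡ 1ℤ
    flip = solve-∀

  -- σ a is the index of the inverse of a + 1 modulo p.
  σ : Fin q → Fin q
  σ a = Fin.fromℕ< (ℕP.≤-trans (ℕP.≤-reflexive (ℕP.suc-pred _ {{ℕ.>-nonZero (residue-positive a)}}))
                               (ℕP.≤-pred (residue<p a)))

  suc-σ : ∀ a → suc (toℕ (σ a)) ≡ residue a
  suc-σ a = trans (cong suc (FinP.toℕ-fromℕ< _)) (ℕP.suc-pred _ {{ℕ.>-nonZero (residue-positive a)}})

  σ-involutive : ∀ a → σ (σ a) ≡ a
  σ-involutive a = FinP.toℕ-injective (ℕP.suc-injective (trans (suc-σ (σ a))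
    (residue-injective (residue<p (σ a)) (s≤s (FinP.toℕ<n a)) residue-σ≡)))
    where
    σ-inverse : + suc (toℕ (σ a)) * + suc (toℕ a) ≡ 1ℤ [modℤ P ]
    σ-inverse = ≡-modℤ-trans (≡⇒≡-modℤ (trans (cong (λ n → + n * + suc (toℕ a)) (suc-σ a))
      (ℤP.*-comm (+ residue a) (+ suc (toℕ a))))) (residue-inverse a)
    residue-σ≡ : + residue (σ a) ≡ + suc (toℕ a) [modℤ P ]
    residue-σ≡ = ≡-modℤ-trans (≡-modℤ-sym (u≡residue (σ a)))
      (inverse-unique {a = + suc (toℕ (σ a))} (u-inverse-mod-P (FinP.toℕ<n (σ a))) σ-inverse)

  B₄≡S₄ : B 4 ≡ S 4 [modℤ P ]
  B₄≡S₄ = begin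
    B 4
      ≈⟨ ∑-cong-modℤ {n = q} (λ a → ^-cong-modℤ 4 (u≡residue a)) ⟩
    ∑[ a < q ] ((+ residue a) ^ 4)
      ≡⟨ sum-cong-≗ {q} (cong (λ n → (+ n) ^ 4) ∘ suc-σ) ⟨
    ∑[ a < q ] ((+ suc (toℕ (σ a))) ^ 4)
      ≡⟨ sum-permute {q} {q} (λ a → (+ suc (toℕ a)) ^ 4) (permutation σ σ σ-involutive σ-involutive) ⟨
    ∑[ a < q ] ((+ suc (toℕ a)) ^ 4)
      ≡⟨ ℤP.+-identityˡ _ ⟨
    S 4
      ∎
    where open ≡-modℤ-Reasoning P

  p∤60 : ¬ p ∣ℕ 60
  p∤60 p∣60 with euclidsLemma 4 15 p-prime p∣60
  ... | inj₁ p∣4  = p∤<7 (from-yes (4 ℕ.<? 7)) p∣4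
  ... | inj₂ p∣15 with euclidsLemma 3 5 p-prime p∣15
  ...   | inj₁ p∣3 = p∤<7 (from-yes (3 ℕ.<? 7)) p∣3
  ...   | inj₂ p∣5 = p∤<7 (from-yes (5 ℕ.<? 7)) p∣5

  P∣S₄ : P ∣ S 4
  P∣S₄ = invertible-cancel (invertible-mod-P^ p∤60 1)
    (divides (2 * (P - 1) * (2 * P - 1) * (3 * P ^ 2 - 3 * P - 1))
      (trans (ℤP.*-comm (S 4) 60) (trans (power-sum-formula 4F p) (factor-P P))))
    where
    factor-P : ∀ P → 2 * P * (P - 1) * (2 * P - 1) * (3 * P ^ 2 - 3 * P - 1) ≡
                     (2 * (P - 1) * (2 * P - 1) * (3 * P ^ 2 - 3 * P - 1)) * P
    factor-P = solve-∀

  P∣B₄ : P ∣ B 4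
  P∣B₄ = ∣-respʳ (∣m∣n⇒∣m+n (_≡_[modℤ_].m∣x-y B₄≡S₄) P∣S₄) (cancel (B 4) (S 4))
    where
    cancel : ∀ b s → b - s + s ≡ b
    cancel = solve-∀

  expansion≡P²B₁ : expansion ≡ P ^ 2 * B 1 [modℤ P⁶ ]
  expansion≡P²B₁ =
    modℤ (invertible-cancel (invertible-mod-P^ p∤60 6) (∣-respʳ P⁶∣combination (sym sixty-fold)))
    where
    sixty-fold : (expansion - P ^ 2 * B 1) * 60 ≡
      ∑[ i < 6 ] ((- P) ^ toℕ i * B (suc (toℕ i)) * faulhaber i P) - 60 * (P ^ 2 * B 1)
    sixty-fold = begin
      (expansion - P ^ 2 * B 1) * 60
        ≡⟨ distrib expansion (P ^ 2 * B 1) ⟩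
      60 * expansion - 60 * (P ^ 2 * B 1)
        ≡⟨ cong (_- 60 * (P ^ 2 * B 1))
                (*-distribˡ-sum {6} 60 (λ i → (- P) ^ toℕ i * B (suc (toℕ i)) * S (toℕ i))) ⟩
      ∑[ i < 6 ] (60 * ((- P) ^ toℕ i * B (suc (toℕ i)) * S (toℕ i))) - 60 * (P ^ 2 * B 1)
        ≡⟨ cong (_- 60 * (P ^ 2 * B 1)) (sum-cong-≗ {6} λ i →
             trans (rotate ((- P) ^ toℕ i * B (suc (toℕ i))) (S (toℕ i)))
                   (cong ((- P) ^ toℕ i * B (suc (toℕ i)) *_) (power-sum-formula i p))) ⟩
      ∑[ i < 6 ] ((- P) ^ toℕ i * B (suc (toℕ i)) * faulhaber i P) - 60 * (P ^ 2 * B 1)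
        ∎
      where
      open ≡-Reasoning
      distrib : ∀ e x → (e - x) * 60 ≡ 60 * e - 60 * x
      distrib = solve-∀
      rotate : ∀ c s → 60 * (c * s) ≡ c * (60 * s)
      rotate = solve-∀
    P⁶∣P³* : ∀ {x} → P ^ 3 ∣ x → P⁶ ∣ P ^ 3 * x
    P⁶∣P³* {x} P³∣x = subst (_∣ P ^ 3 * x) (sym (^-homo-* P 3 3)) (*-monoʳ-∣ (P ^ 3) P³∣x)
    P⁶∣P⁵* : ∀ {x} → P ∣ x → P⁶ ∣ P ^ 5 * x
    P⁶∣P⁵* {x} P∣x = subst (_∣ P ^ 5 * x) (sym (^-suc P 5)) (*-monoʳ-∣ (P ^ 5) P∣x)
    P⁶∣combination : P⁶ ∣ ∑[ i < 6 ] ((- P) ^ toℕ i * B (suc (toℕ i)) * faulhaber i P) - 60 * (P ^ 2 * B 1)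
    P⁶∣combination = ∣-respʳ
      (∣m∣n⇒∣m+n (∣m∣n⇒∣m+n (∣m∣n⇒∣m+n (∣m∣n⇒∣m+n
        (∣n⇒∣m*n (30 * P - 30 * P ^ 2) relation-B₁)
        (∣n⇒∣m*n (10 * P ^ 2 - 10) (P⁶∣P³* relation-B₃)))
        (∣n⇒∣m*n (14 + 15 * P - 20 * P ^ 2 - 15 * P ^ 3 + 6 * P ^ 4) (P⁶∣P⁵* relation-B₅)))
        (∣n⇒∣m*n (15 - 15 * P ^ 2) (P⁶∣P⁵* P∣B₄)))
        (∣n⇒∣m*n ((35 * P - 30 - 25 * P ^ 3 + 30 * P ^ 4 - 10 * P ^ 5) * B 6) ∣-refl))
      (sym (sixty-combination P (B 1) (B 2) (B 3) (B 4) (B 5) (B 6)))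

  Hcoprime-p²≡p²·H : Hcoprime p (p ℕ.^ 2) ≡ ((+ (p ℕ.^ 2)) ℚ./ 1) ℚ.* H q [modℚ p ℕ.^ 6 ]
  Hcoprime-p²≡p²·H = subst (_∣ᵤ ↥ (Hcoprime p (p ℕ.^ 2) ℚ.- (+ (p ℕ.^ 2) ℚ./ 1) ℚ.* H q)) (sym (pos-^ p 6))
    (∣⇒∣ᵤ (↦-same⇒∣↥- Hcoprime↦ p²H↦))
    where
    Hcoprime↦ : Hcoprime p (p ℕ.^ 2) ↦ P ^ 2 * B 1 [modℤ P⁶ ]
    Hcoprime↦ = subst (λ n → Hcoprime p n ↦ P ^ 2 * B 1 [modℤ P⁶ ]) (cong (p ℕ.*_) (sym (ℕP.*-identityʳ p)))
      (↦-resp (↦-Hcoprime-blocks p) (≡-modℤ-trans (≡⇒≡-modℤ blocks≡expansion) expansion≡P²B₁))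
    p²H↦ : (+ (p ℕ.^ 2)) ℚ./ 1 ℚ.* H q ↦ P ^ 2 * B 1 [modℤ P⁶ ]
    p²H↦ = ↦-resp (↦-* _ (H q) (↦-integer (p ℕ.^ 2)) (↦-H q ℕP.≤-refl))
      (≡⇒≡-modℤ (cong (_* B 1) (pos-^ p 2)))

mainTheorem7 : (p : ℕ) → Prime p → p ≥ 7 →
    Hcoprime p (p ℕ.^ 2) ≡ ((+ (p ℕ.^ 2)) ℚ./ 1) ℚ.* H (p ∸ 1) [modℚ p ℕ.^ 6 ]
mainTheorem7 zero    _       ()
mainTheorem7 (suc q) p-prime 7≤p = Hcoprime-p²≡p²·H q p-prime 7≤p
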